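{- Let $1\le k\le n$ be integers. There is a one-to-one correspondence between the noncrossing partitions of $[n]=\{1,\dots,n\}$ with $k$ blocks and the digraphs on vertex set $[n-1]$ consisting of exactly $n-k$ arcs, each arc being either a loop $(i,i)$ or an arc $(i,j)$ with $i<j$, such that the arcs are pairwise independent (no two arcs share a vertex) and noncrossing (there are no two arcs $(a,b),(c,d)$ with $a<c<b<d$).
   Context: A partition of $[n]$ is a set of nonempty pairwise disjoint subsets (blocks) whose union is $[n]$. It is noncrossing if there do not exist $x<u<y<v$ in $[n]$ with $x,y$ in one block and $u,v$ in a different block. A loop is an arc from a vertex to itself; two arcs are independent if they have no vertex in common. -}

module Defs where

open import Level using (0ℓ)
open import Data.Nat using (ℕ; _∸_)
open import Data.Fin using (Fin; _<_)
open import Data.Fin.Subset using (Subset; _∈_; Nonempty)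
open import Data.List using (List; length)
open import Data.List.Relation.Unary.All using (All)
open import Data.List.Relation.Unary.Any using (Any)
open import Data.List.Relation.Unary.AllPairs using (AllPairs)
import Data.List.Membership.Propositional as Mem
open import Data.List.Relation.Binary.Permutation.Propositional
  using (_↭_; ↭-refl; ↭-sym; ↭-trans)
open import Data.Product using (Σ; _×_; _,_; proj₁; proj₂)
open import Data.Sum using (_⊎_)
open import Data.Empty using (⊥)
open import Relation.Nullary using (¬_)
open import Relation.Binary.PropositionalEquality using (_≡_; _≢_)
open import Relation.Binary.Bundles using (Setoid)

-- A partition is a set of blocks, represented as a list of subsets of
-- Fin n; two such lists represent the same partition iff they are
-- permutations of each other (see the setoid below).

Disjoint : ∀ {n} → Subset n → Subset n → Set
Disjoint A B = ∀ x → x ∈ A → x ∈ B → ⊥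

record Partition (n : ℕ) : Set where
  field
    blocks   : List (Subset n)
    nonempty : All Nonempty blocks
    disjoint : AllPairs Disjoint blocks
    covers   : ∀ x → Any (x ∈_) blocks
open Partition public

NonCrossing : ∀ {n} → Partition n → Set
NonCrossing {n} P =
  ∀ (B B' : Subset n) → B Mem.∈ blocks P → B' Mem.∈ blocks P →
  ∀ (x u y v : Fin n) → x < u → u < y → y < v →
  x ∈ B → y ∈ B → u ∈ B' → v ∈ B' → B ≡ B'

NCPartition : ℕ → ℕ → Set
NCPartition n k =
  Σ (Partition n) λ P → NonCrossing P × length (blocks P) ≡ k

NCPartitionSetoid : ℕ → ℕ → Setoid 0ℓ 0ℓ
NCPartitionSetoid n k = record
  { Carrier = NCPartition n k
  ; _≈_ = λ P Q → blocks (proj₁ P) ↭ blocks (proj₁ Q)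
  ; isEquivalence = record { refl = ↭-refl ; sym = ↭-sym ; trans = ↭-trans }
  }

-- Digraphs on vertex set [m] = Fin m given by a set of arcs (i , j),
-- represented as a list of arcs up to permutation.

Arc : ℕ → Set
Arc m = Fin m × Fin m

LoopOrUp : ∀ {m} → Arc m → Set
LoopOrUp (i , j) = i ≡ j ⊎ i < j

Independent : ∀ {m} → Arc m → Arc m → Set
Independent (i , j) (i' , j') = i ≢ i' × i ≢ j' × j ≢ i' × j ≢ j'

ArcsNonCrossing : ∀ {m} → List (Arc m) → Set
ArcsNonCrossing as =
  ∀ a b c d → (a , b) Mem.∈ as → (c , d) Mem.∈ as →
  ¬ (a < c × c < b × b < d)

ArcSystem : ℕ → ℕ → Set
ArcSystem n k =
  Σ (List (Arc (n ∸ 1))) λ as →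
    All LoopOrUp as × AllPairs Independent as × ArcsNonCrossing as ×
    length as ≡ n ∸ k

ArcSystemSetoid : ℕ → ℕ → Setoid 0ℓ 0ℓ
ArcSystemSetoid n k = record
  { Carrier = ArcSystem n k
  ; _≈_ = λ G H → proj₁ G ↭ proj₁ H
  ; isEquivalence = record { refl = ↭-refl ; sym = ↭-sym ; trans = ↭-trans }
  }

{-# OPTIONS --safe #-}
-- A partition of [n] is determined by its predecessor map p, which sends each element to the
-- previous element of its block (and the least element of a block to nothing); the blocks are
-- the classes of elements with a common root under p. The partition is noncrossing iff the links
-- (p y , y) are pairwise noncrossing, and it has k blocks iff p has k roots, i.e. n − k links.
-- Lowering the target of each link i → j + 1 gives the arc (i , j) on [n − 1], a loop when
-- i and i + 1 are consecutive in a block. Injectivity and noncrossing of the links translate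
-- exactly into independence and noncrossing of the arcs: an arc whose source is the head of
-- another arc would come from two crossing links.
module Submission where

open import Defs
open import Data.Nat using (ℕ; _≤_)
open import Function.Bundles using (Bijection)

open import Level using (0ℓ)
open import Data.Nat as N using (zero; suc; _+_; _∸_)
import Data.Nat.Properties as NP
open import Data.Fin as F using (Fin; toℕ; fromℕ<; inject₁)
import Data.Fin.Properties as FP
open import Data.Fin.Subset as S using (Subset; Nonempty)
import Data.Fin.Subset.Properties as SP
open import Data.Maybe as May using (Maybe; just; nothing)
open import Data.List as L using (List; []; _∷_; length; map; filter; mapMaybe; allFin; tabulate)
import Data.List.Properties as LP
open import Data.List.Relation.Unary.All as All using (All; []; _∷_)
import Data.List.Relation.Unary.All.Properties as AllP
open import Data.List.Relation.Unary.Any as Any using (Any; here; there)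
import Data.List.Relation.Unary.Any.Properties as AnyP
open import Data.List.Relation.Unary.AllPairs as AP using (AllPairs; []; _∷_)
import Data.List.Relation.Unary.AllPairs.Properties as APP
open import Data.List.Relation.Unary.Unique.Propositional using (Unique)
import Data.List.Relation.Unary.Unique.Propositional.Properties as UniqueP
open import Data.List.Membership.Propositional using (_∈_; find; lose)
import Data.List.Membership.Propositional.Properties as MemP
open import Data.List.Membership.Propositional.Properties.WithK using (unique∧set⇒bag)
open import Data.List.Relation.Binary.BagAndSetEquality using (∼bag⇒↭)
open import Data.List.Relation.Binary.Permutation.Propositional
  using (_↭_; ↭-sym; ↭-trans; ↭-reflexive)
import Data.List.Relation.Binary.Permutation.Propositional.Properties as PermP
open import Data.Product using (Σ; ∃; ∃₂; _×_; _,_; proj₁; proj₂)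
open import Data.Sum using (_⊎_; inj₁; inj₂)
open import Data.Empty using (⊥; ⊥-elim)
open import Function using (_on_)
open import Function.Bundles using (mk⇔)
import Function.Construct.Composition as Compose
open import Relation.Nullary using (¬_; yes; no; does)
open import Relation.Nullary.Decidable using (_×-dec_; dec-true)
open import Relation.Unary using (Decidable; _⊆_)
open import Relation.Binary using (Setoid)
open import Relation.Binary.Definitions using (tri<; tri≈; tri>)
open import Relation.Binary.PropositionalEquality
  using (_≡_; _≢_; _≗_; refl; sym; trans; cong; cong₂; subst; subst₂; module ≡-Reasoning)
import Data.Vec as Vec
import Data.Vec.Properties as VecP

module _ {n : ℕ} (Q : Fin n → Set) where

  GreatestBelow : ℕ → Maybe (Fin n) → Set
  GreatestBelow k nothing  = ∀ z → toℕ z N.< k → ¬ Q z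
  GreatestBelow k (just x) = toℕ x N.< k × Q x × (∀ z → toℕ z N.< k → Q z → z F.≤ x)

  below-skipped : ∀ {k z} → (∀ z → toℕ z ≡ k → ¬ Q z) →
    toℕ z N.< suc k → Q z → toℕ z N.< k
  below-skipped ¬Q[k] z<1+k qz with NP.m≤n⇒m<n∨m≡n (NP.≤-pred z<1+k)
  ... | inj₁ z<k = z<k
  ... | inj₂ z≡k = ⊥-elim (¬Q[k] _ z≡k qz)

  GreatestBelow-skip : ∀ {k r} → (∀ z → toℕ z ≡ k → ¬ Q z) →
    GreatestBelow k r → GreatestBelow (suc k) r
  GreatestBelow-skip {r = nothing} ¬Q[k] none z z<1+k qz =
    none z (below-skipped ¬Q[k] z<1+k qz) qz
  GreatestBelow-skip {r = just x} ¬Q[k] (x<k , qx , max) =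
    NP.m<n⇒m<1+n x<k , qx , λ z z<1+k qz → max z (below-skipped ¬Q[k] z<1+k qz) qz

  greatestBelow : Decidable Q → ℕ → Maybe (Fin n)
  greatestBelow Q? zero = nothing
  greatestBelow Q? (suc k) with k N.<? n
  ... | no _ = greatestBelow Q? k
  ... | yes k<n with Q? (fromℕ< k<n)
  ...   | yes _ = just (fromℕ< k<n)
  ...   | no _ = greatestBelow Q? k

  greatestBelow-spec : (Q? : Decidable Q) → ∀ k → GreatestBelow k (greatestBelow Q? k)
  greatestBelow-spec Q? zero = λ _ ()
  greatestBelow-spec Q? (suc k) with k N.<? n
  ... | no k≮n = GreatestBelow-skip (λ z z≡k _ → k≮n (subst (N._< n) z≡k (FP.toℕ<n z)))
                   (greatestBelow-spec Q? k)
  ... | yes k<n with Q? (fromℕ< k<n)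
  ...   | yes q = NP.≤-reflexive (cong suc toℕ[k]) , q ,
                  λ z z<1+k _ → subst (toℕ z N.≤_) (sym toℕ[k]) (NP.≤-pred z<1+k)
    where
    toℕ[k] : toℕ (fromℕ< k<n) ≡ k
    toℕ[k] = FP.toℕ-fromℕ< k<n
  ...   | no ¬q = GreatestBelow-skip
                   (λ z z≡k qz → ¬q (subst Q (FP.toℕ-injective (trans z≡k (sym toℕ[k]))) qz))
                   (greatestBelow-spec Q? k)
    where
    toℕ[k] : toℕ (fromℕ< k<n) ≡ k
    toℕ[k] = FP.toℕ-fromℕ< k<n

GreatestBelow-unique : ∀ {n} {Q Q′ : Fin n → Set} → Q ⊆ Q′ → Q′ ⊆ Q → ∀ {k r r′} →
  GreatestBelow Q k r → GreatestBelow Q′ k r′ → r ≡ r′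
GreatestBelow-unique _ _ {r = nothing} {nothing} _ _ = refl
GreatestBelow-unique _ Q′⊆Q {r = nothing} {just x} none (x<k , q′x , _) =
  ⊥-elim (none x x<k (Q′⊆Q q′x))
GreatestBelow-unique Q⊆Q′ _ {r = just x} {nothing} (x<k , qx , _) none =
  ⊥-elim (none x x<k (Q⊆Q′ qx))
GreatestBelow-unique Q⊆Q′ Q′⊆Q {r = just x} {just x′} (x<k , qx , max) (x′<k , q′x′ , max′) =
  cong just (FP.≤-antisym (max′ x x<k (Q⊆Q′ qx)) (max x′ x′<k (Q′⊆Q q′x′)))

module _ {A : Set} where

  AllPairs-lookup₂ : ∀ {R : A → A → Set} {xs a b} → AllPairs R xs → a ∈ xs → b ∈ xs →
    a ≡ b ⊎ R a b ⊎ R b a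
  AllPairs-lookup₂ (_ ∷ _) (here refl) (here refl) = inj₁ refl
  AllPairs-lookup₂ (Rx ∷ _) (here refl) (there b∈) = inj₂ (inj₁ (All.lookup Rx b∈))
  AllPairs-lookup₂ (Rx ∷ _) (there a∈) (here refl) = inj₂ (inj₂ (All.lookup Rx a∈))
  AllPairs-lookup₂ (_ ∷ Rxs) (there a∈) (there b∈) = AllPairs-lookup₂ Rxs a∈ b∈

  unique⇒AllPairs : ∀ {R : A → A → Set} {xs} → Unique xs →
    (∀ {a b} → a ∈ xs → b ∈ xs → a ≢ b → R a b) → AllPairs R xs
  unique⇒AllPairs [] _ = []
  unique⇒AllPairs (x∉ ∷ u) R′ =
    All.tabulate (λ b∈ → R′ (here refl) (there b∈) (All.lookup x∉ b∈)) ∷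
    unique⇒AllPairs u (λ a∈ b∈ → R′ (there a∈) (there b∈))

  unique-sameMembers⇒↭ : ∀ {xs ys : List A} → Unique xs → Unique ys →
    (∀ {z} → z ∈ xs → z ∈ ys) → (∀ {z} → z ∈ ys → z ∈ xs) → xs ↭ ys
  unique-sameMembers⇒↭ ux uy to from = ∼bag⇒↭ (unique∧set⇒bag ux uy (mk⇔ to from))

module _ {A B : Set} {f : A → Maybe B} where

  ∈-mapMaybe⁺ : ∀ {x y xs} → x ∈ xs → f x ≡ just y → y ∈ mapMaybe f xs
  ∈-mapMaybe⁺ {x} (here refl) fx≡y with f x
  ∈-mapMaybe⁺ (here refl) refl | just _ = here refl
  ∈-mapMaybe⁺ {xs = x′ ∷ _} (there x∈) fx≡y with f x′
  ... | nothing = ∈-mapMaybe⁺ x∈ fx≡y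
  ... | just _ = there (∈-mapMaybe⁺ x∈ fx≡y)

  ∈-mapMaybe⁻ : ∀ {y xs} → y ∈ mapMaybe f xs → ∃ λ x → x ∈ xs × f x ≡ just y
  ∈-mapMaybe⁻ {xs = x ∷ xs} y∈ with f x in fx≡
  ∈-mapMaybe⁻ {xs = x ∷ _} (here refl) | just _ = x , here refl , fx≡
  ∈-mapMaybe⁻ (there y∈) | just _ with ∈-mapMaybe⁻ y∈
  ... | x′ , x′∈ , fx′≡ = x′ , there x′∈ , fx′≡
  ∈-mapMaybe⁻ y∈ | nothing with ∈-mapMaybe⁻ y∈
  ... | x′ , x′∈ , fx′≡ = x′ , there x′∈ , fx′≡

  mapMaybe-unique : (∀ {x x′ y} → f x ≡ just y → f x′ ≡ just y → x ≡ x′) →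
    ∀ {xs} → Unique xs → Unique (mapMaybe f xs)
  mapMaybe-unique _ [] = []
  mapMaybe-unique f-inj {x ∷ xs} (x∉ ∷ u) with f x in fx≡
  ... | nothing = mapMaybe-unique f-inj u
  ... | just y = All.tabulate distinct ∷ mapMaybe-unique f-inj u
    where
    distinct : ∀ {y′} → y′ ∈ mapMaybe f xs → y ≢ y′
    distinct y′∈ refl with ∈-mapMaybe⁻ y′∈
    ... | x′ , x′∈ , fx′≡ = All.lookup x∉ x′∈ (f-inj fx≡ fx′≡)

-- p y is the previous element of the block of y, or nothing if y is least in its block.
PredMap : ℕ → Set
PredMap n = Fin n → Maybe (Fin n)

record IsNCPredMap {n : ℕ} (p : PredMap n) : Set where
  field
    decreasing  : ∀ {y x} → p y ≡ just x → x F.< y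
    injective   : ∀ {y y′ x} → p y ≡ just x → p y′ ≡ just x → y ≡ y′
    noncrossing : ∀ {a b c d} → p b ≡ just a → p d ≡ just c →
                  ¬ (a F.< c × c F.< b × b F.< d)

IsNCPredMap-resp : ∀ {n} {p q : PredMap n} → p ≗ q → IsNCPredMap q → IsNCPredMap p
IsNCPredMap-resp {p = p} {q} p≗q isNC = record
  { decreasing  = λ e → decreasing (toq e)
  ; injective   = λ e e′ → injective (toq e) (toq e′)
  ; noncrossing = λ e e′ → noncrossing (toq e) (toq e′)
  }
  where
  open IsNCPredMap isNC
  toq : ∀ {y x} → p y ≡ just x → q y ≡ just x
  toq {y} e = trans (sym (p≗q y)) e

module _ {n : ℕ} (p : PredMap n) where

  isRoot? : Decidable (λ y → p y ≡ nothing)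
  isRoot? y with p y
  ... | nothing = yes refl
  ... | just _ = no λ ()

  roots : List (Fin n)
  roots = filter isRoot? (allFin n)

  data Reach : Fin n → Fin n → Set where
    done : ∀ {y} → Reach y y
    step : ∀ {y w x} → p y ≡ just w → Reach w x → Reach y x

  Reach-trans : ∀ {x y z} → Reach x y → Reach y z → Reach x z
  Reach-trans done r = r
  Reach-trans (step e r) r′ = step e (Reach-trans r r′)

  Reach-last : ∀ {y x} → Reach y x → x ≢ y → ∃ λ w → p w ≡ just x × Reach y w
  Reach-last done x≢y = ⊥-elim (x≢y refl)
  Reach-last {y} {x} (step {w = w} e r) x≢y with x F.≟ w
  ... | yes refl = y , e , done
  ... | no x≢w with Reach-last r x≢w
  ...   | w′ , e′ , r′ = w′ , e′ , step e r′

  RootOf : Fin n → Fin n → Set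
  RootOf y r = Reach y r × p r ≡ nothing

  RootOf-unique : ∀ {y r r′} → RootOf y r → RootOf y r′ → r ≡ r′
  RootOf-unique (r , pr) (r′ , pr′) = ends r r′ pr pr′
    where
    ends : ∀ {y r r′} → Reach y r → Reach y r′ →
           p r ≡ nothing → p r′ ≡ nothing → r ≡ r′
    ends done done _ _ = refl
    ends done (step e _) pr _ with trans (sym pr) e
    ... | ()
    ends (step e _) done _ pr′ with trans (sym pr′) e
    ... | ()
    ends (step e r) (step e′ r′) pr pr′ with trans (sym e) e′
    ... | refl = ends r r′ pr pr′

  -- Fuel n suffices because a noncrossing predecessor map is decreasing (see root-spec).
  rootWithin : ℕ → Fin n → Fin n
  rootWithin zero y = y
  rootWithin (suc f) y with p y
  ... | nothing = y
  ... | just x = rootWithin f x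

  root : Fin n → Fin n
  root = rootWithin n

module Chains {n : ℕ} {p : PredMap n} (isNC : IsNCPredMap p) where
  open IsNCPredMap isNC

  Reach-≤ : ∀ {y x} → Reach p y x → x F.≤ y
  Reach-≤ done = NP.≤-refl
  Reach-≤ (step e r) = NP.≤-trans (Reach-≤ r) (NP.<⇒≤ (decreasing e))

  rootWithin-spec : ∀ f y → toℕ y N.< f → RootOf p y (rootWithin p f y)
  rootWithin-spec (suc f) y y<1+f with p y in e
  ... | nothing = done , e
  ... | just x with rootWithin-spec f x (NP.<-≤-trans (decreasing e) (NP.≤-pred y<1+f))
  ...   | r , pr = step e r , pr

  root-spec : ∀ y → RootOf p y (root p y)
  root-spec y = rootWithin-spec n y (FP.toℕ<n y)

  root-isRoot : ∀ y → p (root p y) ≡ nothing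
  root-isRoot y = proj₂ (root-spec y)

  root-fixed : ∀ {r} → p r ≡ nothing → root p r ≡ r
  root-fixed e = RootOf-unique p (root-spec _) (done , e)

  root-Reach : ∀ {y x} → Reach p y x → root p x ≡ root p y
  root-Reach r = RootOf-unique p (Reach-trans p r (proj₁ (root-spec _)) , root-isRoot _) (root-spec _)

  Reach-connex : ∀ {x z r} → Reach p x r → Reach p z r → Reach p x z ⊎ Reach p z x
  Reach-connex done z↝r = inj₂ z↝r
  Reach-connex {z = z} (step {w = x₁} e x₁↝r) z↝r with Reach-connex x₁↝r z↝r
  ... | inj₁ x₁↝z = inj₁ (step e x₁↝z)
  ... | inj₂ z↝x₁ with z F.≟ x₁
  ...   | yes refl = inj₁ (step e done)
  ...   | no z≢x₁ with Reach-last p z↝x₁ (λ x₁≡z → z≢x₁ (sym x₁≡z))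
  ...     | w , e′ , z↝w with injective e′ e
  ...       | refl = inj₂ z↝w

  sameRoot⇒Reach : ∀ {x y} → root p x ≡ root p y → x F.< y → Reach p y x
  sameRoot⇒Reach {x} {y} rx≡ry x<y
    with Reach-connex (proj₁ (root-spec x)) (subst (Reach p y) (sym rx≡ry) (proj₁ (root-spec y)))
  ... | inj₁ x↝y = ⊥-elim (NP.<⇒≱ x<y (Reach-≤ x↝y))
  ... | inj₂ y↝x = y↝x

module _ {n : ℕ} {bs : List (Subset n)} where

  blocks-meet⇒≡ : ∀ {B B′ x} → AllPairs Disjoint bs → B ∈ bs → B′ ∈ bs →
    x S.∈ B → x S.∈ B′ → B ≡ B′
  blocks-meet⇒≡ {x = x} disj B∈ B′∈ x∈B x∈B′ with AllPairs-lookup₂ disj B∈ B′∈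
  ... | inj₁ B≡B′ = B≡B′
  ... | inj₂ (inj₁ B⊥B′) = ⊥-elim (B⊥B′ x x∈B x∈B′)
  ... | inj₂ (inj₂ B′⊥B) = ⊥-elim (B′⊥B x x∈B′ x∈B)

disjoint⇒unique : ∀ {n} {bs : List (Subset n)} →
  All Nonempty bs → AllPairs Disjoint bs → Unique bs
disjoint⇒unique [] [] = []
disjoint⇒unique ((x , x∈B) ∷ ne) (B⊥ ∷ disj) =
  All.map (λ B⊥B′ B≡B′ → B⊥B′ x x∈B (subst (x S.∈_) B≡B′ x∈B)) B⊥ ∷
  disjoint⇒unique ne disj

module _ {n : ℕ} (P : Partition n) where

  SameBlock : Fin n → Fin n → Set
  SameBlock x y = Any (λ B → x S.∈ B × y S.∈ B) (blocks P)

  SameBlock? : ∀ x → Decidable (SameBlock x)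
  SameBlock? x y = Any.any? (λ B → (x SP.∈? B) ×-dec (y SP.∈? B)) (blocks P)

  SameBlock-refl : ∀ x → SameBlock x x
  SameBlock-refl x = Any.map (λ x∈B → x∈B , x∈B) (covers P x)

  SameBlock-sym : ∀ {x y} → SameBlock x y → SameBlock y x
  SameBlock-sym = Any.map (λ (x∈B , y∈B) → y∈B , x∈B)

  SameBlock-trans : ∀ {x y z} → SameBlock x y → SameBlock y z → SameBlock x z
  SameBlock-trans xy yz with find xy | find yz
  ... | B , B∈ , x∈B , y∈B | B′ , B′∈ , y∈B′ , z∈B′
    with blocks-meet⇒≡ (disjoint P) B∈ B′∈ y∈B y∈B′
  ... | refl = lose B∈ (x∈B , z∈B′)

  predOf : PredMap n
  predOf y = greatestBelow (SameBlock y) (SameBlock? y) (toℕ y)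

  predOf-spec : ∀ y → GreatestBelow (SameBlock y) (toℕ y) (predOf y)
  predOf-spec y = greatestBelow-spec (SameBlock y) (SameBlock? y) (toℕ y)

  predOf-just : ∀ {y x} → predOf y ≡ just x → GreatestBelow (SameBlock y) (toℕ y) (just x)
  predOf-just {y} e = subst (GreatestBelow (SameBlock y) (toℕ y)) e (predOf-spec y)

  predOf-nothing : ∀ {y} → predOf y ≡ nothing → GreatestBelow (SameBlock y) (toℕ y) nothing
  predOf-nothing {y} e = subst (GreatestBelow (SameBlock y) (toℕ y)) e (predOf-spec y)

  predOf-injective : ∀ {y y′ x} → predOf y ≡ just x → predOf y′ ≡ just x → y ≡ y′
  predOf-injective {y} {y′} e e′ with predOf-just e | predOf-just e′ | FP.<-cmp y y′
  ... | x<y , yx , _ | _ , y′x , max′ | tri< y<y′ _ _ =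
        ⊥-elim (NP.<⇒≱ x<y (max′ y y<y′ (SameBlock-trans y′x (SameBlock-sym yx))))
  ... | _ | _ | tri≈ _ y≡y′ _ = y≡y′
  ... | _ , yx , max | x<y′ , y′x , _ | tri> _ _ y′<y =
        ⊥-elim (NP.<⇒≱ x<y′ (max y′ y′<y (SameBlock-trans yx (SameBlock-sym y′x))))

  -- Noncrossing puts a, b, c, d into one block; then a < c < b contradicts the maximality of a.
  predOf-noncrossing : NonCrossing P → ∀ {a b c d} → predOf b ≡ just a → predOf d ≡ just c →
    ¬ (a F.< c × c F.< b × b F.< d)
  predOf-noncrossing nc e e′ (a<c , c<b , b<d) with predOf-just e | predOf-just e′
  ... | _ , ba , max | _ , dc , _ with find ba | find dc
  ... | B , B∈ , b∈B , a∈B | B′ , B′∈ , d∈B′ , c∈B′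
    with nc B B′ B∈ B′∈ _ _ _ _ a<c c<b b<d a∈B b∈B c∈B′ d∈B′
  ... | refl = NP.<⇒≱ a<c (max _ c<b (lose B∈ (b∈B , c∈B′)))

  predOf-isNC : NonCrossing P → IsNCPredMap predOf
  predOf-isNC nc = record
    { decreasing  = λ e → proj₁ (predOf-just e)
    ; injective   = predOf-injective
    ; noncrossing = predOf-noncrossing nc
    }

predOf-↭ : ∀ {n} {P Q : Partition n} → blocks P ↭ blocks Q → predOf P ≗ predOf Q
predOf-↭ {P = P} {Q} σ y =
  GreatestBelow-unique (PermP.Any-resp-↭ σ) (PermP.Any-resp-↭ (↭-sym σ))
    (predOf-spec P y) (predOf-spec Q y)

module _ {n : ℕ} (p : PredMap n) where

  classOf : Fin n → Subset n
  classOf r = Vec.tabulate (λ y → does (root p y F.≟ r))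

  ∈-classOf⁺ : ∀ {y r} → root p y ≡ r → y S.∈ classOf r
  ∈-classOf⁺ {y} {r} e =
    VecP.lookup⇒[]= y (classOf r) (trans (VecP.lookup∘tabulate _ y) (dec-true (root p y F.≟ r) e))

  ∈-classOf⁻ : ∀ {y r} → y S.∈ classOf r → root p y ≡ r
  ∈-classOf⁻ {y} {r} y∈
    with root p y F.≟ r | trans (sym (VecP.lookup∘tabulate _ y)) (VecP.[]=⇒lookup y∈)
  ... | yes e | _ = e
  ... | no _ | ()

  canonicalBlocks : List (Subset n)
  canonicalBlocks = map classOf (roots p)

module Canonical {n : ℕ} {p : PredMap n} (isNC : IsNCPredMap p) where
  open IsNCPredMap isNC
  open Chains isNC

  ∈-roots⁻ : ∀ {r} → r ∈ roots p → p r ≡ nothing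
  ∈-roots⁻ r∈ = proj₂ (MemP.∈-filter⁻ (isRoot? p) {xs = allFin n} r∈)

  root∈roots : ∀ y → root p y ∈ roots p
  root∈roots y = MemP.∈-filter⁺ (isRoot? p) (MemP.∈-allFin _) (root-isRoot y)

  canonical : Partition n
  canonical = record
    { blocks   = canonicalBlocks p
    ; nonempty = AllP.map⁺ (All.tabulate λ r∈ → _ , ∈-classOf⁺ p (root-fixed (∈-roots⁻ r∈)))
    ; disjoint = APP.map⁺ (AP.map classes-disjoint (UniqueP.filter⁺ (isRoot? p) (UniqueP.allFin⁺ n)))
    ; covers   = λ y → AnyP.map⁺ (lose (root∈roots y) (∈-classOf⁺ p refl))
    }
    where
    classes-disjoint : ∀ {r r′} → r ≢ r′ → Disjoint (classOf p r) (classOf p r′)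
    classes-disjoint r≢r′ y y∈ y∈′ = r≢r′ (trans (sym (∈-classOf⁻ p y∈)) (∈-classOf⁻ p y∈′))

  SameBlock-canonical⁻ : ∀ {x y} → SameBlock canonical x y → root p x ≡ root p y
  SameBlock-canonical⁻ xy with find xy
  ... | _ , B∈ , x∈B , y∈B with MemP.∈-map⁻ (classOf p) B∈
  ... | _ , _ , refl = trans (∈-classOf⁻ p x∈B) (sym (∈-classOf⁻ p y∈B))

  SameBlock-canonical⁺ : ∀ {x y} → root p x ≡ root p y → SameBlock canonical x y
  SameBlock-canonical⁺ {y = y} e =
    lose (MemP.∈-map⁺ (classOf p) (root∈roots y)) (∈-classOf⁺ p e , ∈-classOf⁺ p refl)

  link-across : ∀ {y x u} → Reach p y x → x F.< u → u F.< y → root p u ≢ root p y →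
    ∃₂ λ a b → p b ≡ just a × a F.< u × u F.< b × Reach p y b × Reach p a x
  link-across done x<u u<y _ = ⊥-elim (NP.<-asym x<u u<y)
  link-across {y} {u = u} (step {w = w} e w↝x) x<u u<y ru≢ry with FP.<-cmp w u
  ... | tri< w<u _ _ = w , y , e , w<u , u<y , done , w↝x
  ... | tri≈ _ refl _ = ⊥-elim (ru≢ry (root-Reach (step e done)))
  ... | tri> _ _ u<w
    with link-across w↝x x<u u<w (λ ru≡rw → ru≢ry (trans ru≡rw (root-Reach (step e done))))
  ...   | a , b , e′ , a<u , u<b , w↝b , a↝x = a , b , e′ , a<u , u<b , step e w↝b , a↝x

  -- Otherwise the chain from y down to x crosses u by a link a ← b with a < u < b ≤ y, and the
  -- chain from v down to u crosses b by a link c ← d with u ≤ c < b < d: these links cross.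
  sameRoot-noncrossing : ∀ {x u y v} → x F.< u → u F.< y → y F.< v →
    root p x ≡ root p y → root p u ≡ root p v → root p x ≡ root p u
  sameRoot-noncrossing {x} {u} x<u u<y y<v rx≡ry ru≡rv with root p x F.≟ root p u
  ... | yes rx≡ru = rx≡ru
  ... | no rx≢ru
    with link-across (sameRoot⇒Reach rx≡ry (NP.<-trans x<u u<y)) x<u u<y
                     (λ ru≡ry → rx≢ru (trans rx≡ry (sym ru≡ry)))
  ... | a , b , pb≡a , a<u , u<b , y↝b , _
    with link-across (sameRoot⇒Reach ru≡rv (NP.<-trans u<y y<v)) u<b
                     (NP.≤-<-trans (Reach-≤ y↝b) y<v)
                     (λ rb≡rv → rx≢ru (trans (trans rx≡ry (sym (root-Reach y↝b))) (trans rb≡rv (sym ru≡rv))))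
  ... | c , d , pd≡c , c<b , b<d , _ , c↝u =
    ⊥-elim (noncrossing pb≡a pd≡c (NP.<-≤-trans a<u (Reach-≤ c↝u) , c<b , b<d))

  canonical-noncrossing : NonCrossing canonical
  canonical-noncrossing B B′ B∈ B′∈ x u y v x<u u<y y<v x∈B y∈B u∈B′ v∈B′
    with MemP.∈-map⁻ (classOf p) B∈ | MemP.∈-map⁻ (classOf p) B′∈
  ... | _ , _ , refl | _ , _ , refl
    with ∈-classOf⁻ p x∈B | ∈-classOf⁻ p y∈B | ∈-classOf⁻ p u∈B′ | ∈-classOf⁻ p v∈B′
  ... | refl | ry≡rx | refl | rv≡ru =
    cong (classOf p) (sameRoot-noncrossing x<u u<y y<v (sym ry≡rx) (sym rv≡ru))

  p-GreatestBelow : ∀ y → GreatestBelow (SameBlock canonical y) (toℕ y) (p y)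
  p-GreatestBelow y with p y in e
  ... | nothing = λ z z<y yz → NP.<⇒≱ z<y (Reach-≤ (z↝y z yz))
    where
    z↝y : ∀ z → SameBlock canonical y z → Reach p z y
    z↝y z yz =
      subst (Reach p z) (trans (sym (SameBlock-canonical⁻ yz)) (root-fixed e)) (proj₁ (root-spec z))
  ... | just x = decreasing e , SameBlock-canonical⁺ (sym (root-Reach (step e done))) , max
    where
    max : ∀ z → toℕ z N.< toℕ y → SameBlock canonical y z → z F.≤ x
    max z z<y yz with sameRoot⇒Reach (sym (SameBlock-canonical⁻ yz)) z<y
    ... | done = ⊥-elim (NP.<-irrefl refl z<y)
    ... | step e′ x′↝z with trans (sym e) e′
    ...   | refl = Reach-≤ x′↝z

  predOf-canonical : predOf canonical ≗ p
  predOf-canonical y =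
    GreatestBelow-unique (λ yz → yz) (λ yz → yz) (predOf-spec canonical y) (p-GreatestBelow y)

-- Stated for any p ≗ predOf P, so that partitions with equal predecessor maps are
-- compared with literally the same canonical blocks.
module BlocksAreClasses {n : ℕ} (P : Partition n) (nc : NonCrossing P)
                        {p : PredMap n} (p≗ : p ≗ predOf P) where

  isNC : IsNCPredMap p
  isNC = IsNCPredMap-resp p≗ (predOf-isNC P nc)

  open Chains isNC
  open Canonical isNC

  Reach⇒SameBlock : ∀ {y x} → Reach p y x → SameBlock P y x
  Reach⇒SameBlock done = SameBlock-refl P _
  Reach⇒SameBlock (step e w↝x) =
    SameBlock-trans P (proj₁ (proj₂ (predOf-just P (trans (sym (p≗ _)) e)))) (Reach⇒SameBlock w↝x)

  isRoot⇒least : ∀ {r} → p r ≡ nothing → ∀ z → SameBlock P r z → r F.≤ z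
  isRoot⇒least {r} e z rz = NP.≮⇒≥ (λ z<r → predOf-nothing P (trans (sym (p≗ r)) e) z z<r rz)

  SameBlock⇒sameRoot : ∀ {x y} → SameBlock P x y → root p x ≡ root p y
  SameBlock⇒sameRoot {x} {y} xy =
    FP.≤-antisym (isRoot⇒least (root-isRoot x) _ rx-ry)
                 (isRoot⇒least (root-isRoot y) _ (SameBlock-sym P rx-ry))
    where
    rx-ry : SameBlock P (root p x) (root p y)
    rx-ry = SameBlock-trans P (SameBlock-sym P (Reach⇒SameBlock (proj₁ (root-spec x))))
              (SameBlock-trans P xy (Reach⇒SameBlock (proj₁ (root-spec y))))

  sameRoot⇒SameBlock : ∀ {x y} → root p x ≡ root p y → SameBlock P x y
  sameRoot⇒SameBlock {x} {y} rx≡ry =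
    SameBlock-trans P (Reach⇒SameBlock (proj₁ (root-spec x)))
      (SameBlock-sym P (subst (SameBlock P y) (sym rx≡ry) (Reach⇒SameBlock (proj₁ (root-spec y)))))

  block≡classOf : ∀ {B x} → B ∈ blocks P → x S.∈ B → B ≡ classOf p (root p x)
  block≡classOf {B} {x} B∈ x∈B = SP.⊆-antisym
    (λ y∈B → ∈-classOf⁺ p (sym (SameBlock⇒sameRoot (lose B∈ (x∈B , y∈B)))))
    (λ y∈ → inB (find (sameRoot⇒SameBlock (sym (∈-classOf⁻ p y∈)))))
    where
    inB : ∀ {y} → ∃ (λ B′ → B′ ∈ blocks P × x S.∈ B′ × y S.∈ B′) → y S.∈ B
    inB (B′ , B′∈ , x∈B′ , y∈B′) =
      subst (_ S.∈_) (blocks-meet⇒≡ (disjoint P) B′∈ B∈ x∈B′ x∈B) y∈B′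

  blocks↭canonical : blocks P ↭ blocks canonical
  blocks↭canonical = unique-sameMembers⇒↭
    (disjoint⇒unique (nonempty P) (disjoint P))
    (disjoint⇒unique (nonempty canonical) (disjoint canonical))
    block∈ class∈
    where
    block∈ : ∀ {B} → B ∈ blocks P → B ∈ canonicalBlocks p
    block∈ B∈ with All.lookup (nonempty P) B∈
    ... | x , x∈B = subst (_∈ canonicalBlocks p) (sym (block≡classOf B∈ x∈B))
                          (MemP.∈-map⁺ (classOf p) (root∈roots x))
    class∈ : ∀ {B} → B ∈ canonicalBlocks p → B ∈ blocks P
    class∈ B∈ with MemP.∈-map⁻ (classOf p) B∈
    ... | r , r∈ , refl with find (covers P r)
    ...   | B′ , B′∈ , r∈B′ = subst (_∈ blocks P) B′≡class B′∈
      where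
      B′≡class : B′ ≡ classOf p r
      B′≡class = trans (block≡classOf B′∈ r∈B′) (cong (classOf p) (root-fixed (∈-roots⁻ r∈)))

NCPredMap : ℕ → ℕ → Set
NCPredMap n k = Σ (PredMap n) λ p → IsNCPredMap p × length (roots p) ≡ k

NCPredMapSetoid : ℕ → ℕ → Setoid 0ℓ 0ℓ
NCPredMapSetoid n k = record
  { Carrier       = NCPredMap n k
  ; _≈_           = λ p q → proj₁ p ≗ proj₁ q
  ; isEquivalence = record
    { refl  = λ _ → refl
    ; sym   = λ p≗q y → sym (p≗q y)
    ; trans = λ p≗q q≗r y → trans (p≗q y) (q≗r y)
    }
  }

module _ {n k : ℕ} where

  length-roots-predOf : (P : Partition n) → NonCrossing P → length (blocks P) ≡ k →
    length (roots (predOf P)) ≡ k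
  length-roots-predOf P nc len = begin
    length (roots (predOf P))            ≡⟨ LP.length-map (classOf (predOf P)) (roots (predOf P)) ⟨
    length (canonicalBlocks (predOf P))  ≡⟨ PermP.↭-length (BlocksAreClasses.blocks↭canonical P nc λ _ → refl) ⟨
    length (blocks P)                    ≡⟨ len ⟩
    k                                    ∎
    where open ≡-Reasoning

  toPredMap : NCPartition n k → NCPredMap n k
  toPredMap (P , nc , len) = predOf P , predOf-isNC P nc , length-roots-predOf P nc len

  toPredMap-injective : ∀ {P Q : NCPartition n k} → proj₁ (toPredMap P) ≗ proj₁ (toPredMap Q) →
    blocks (proj₁ P) ↭ blocks (proj₁ Q)
  toPredMap-injective {P , ncP , _} {Q , ncQ , _} pP≗pQ =
    ↭-trans (BlocksAreClasses.blocks↭canonical P ncP λ _ → refl)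
            (↭-sym (BlocksAreClasses.blocks↭canonical Q ncQ pP≗pQ))

  toPredMap-surjective : ∀ (p : NCPredMap n k) → Σ (NCPartition n k) λ P →
    ∀ {Q : NCPartition n k} → blocks (proj₁ Q) ↭ blocks (proj₁ P) →
    proj₁ (toPredMap Q) ≗ proj₁ p
  toPredMap-surjective (p , isNC , len) =
    (canonical , canonical-noncrossing , trans (LP.length-map (classOf p) (roots p)) len) ,
    λ {Q} σ y → trans (predOf-↭ {P = proj₁ Q} {canonical} σ y) (predOf-canonical y)
    where open Canonical isNC

partition⤖predMap : ∀ n k → Bijection (NCPartitionSetoid n k) (NCPredMapSetoid n k)
partition⤖predMap n k = record
  { to        = toPredMap
  ; cong      = λ {P} {Q} → predOf-↭ {P = proj₁ P} {proj₁ Q}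
  ; bijective = (λ {P} {Q} → toPredMap-injective {P = P} {Q}) , toPredMap-surjective
  }

isRoot-zero : ∀ {m} {p : PredMap (suc m)} → IsNCPredMap p → p F.zero ≡ nothing
isRoot-zero {p = p} isNC with p F.zero in e
... | nothing = refl
... | just _ = ⊥-elim (NP.n≮0 (IsNCPredMap.decreasing isNC e))

module _ {m : ℕ} where

  -- lowerOr x j is x read in Fin m; the default j is only used when x = m.
  lowerOr : Fin (suc m) → Fin m → Fin m
  lowerOr x j with toℕ x N.<? m
  ... | yes x<m = fromℕ< x<m
  ... | no _ = j

  toℕ-lowerOr : ∀ {x j} → toℕ x N.≤ toℕ j → toℕ (lowerOr x j) ≡ toℕ x
  toℕ-lowerOr {x} {j} x≤j with toℕ x N.<? m
  ... | yes x<m = FP.toℕ-fromℕ< x<m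
  ... | no x≮m = ⊥-elim (x≮m (NP.≤-<-trans x≤j (FP.toℕ<n j)))

  inject₁-lowerOr : ∀ {x j} → toℕ x N.≤ toℕ j → inject₁ (lowerOr x j) ≡ x
  inject₁-lowerOr x≤j = FP.toℕ-injective (trans (FP.toℕ-inject₁ _) (toℕ-lowerOr x≤j))

  lowerOr-inject₁ : ∀ {i j} → i F.≤ j → lowerOr (inject₁ i) j ≡ i
  lowerOr-inject₁ {i} i≤j = FP.toℕ-injective (trans (toℕ-lowerOr i≤ℕj) (FP.toℕ-inject₁ i))
    where
    i≤ℕj : toℕ (inject₁ i) N.≤ toℕ _
    i≤ℕj = subst (N._≤ _) (sym (FP.toℕ-inject₁ i)) i≤j

  -- The arc (i , j) on [n - 1] records that i and j + 1 are consecutive in a block of [n].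
  arcInto : PredMap (suc m) → Fin m → Maybe (Arc m)
  arcInto p j = May.map (λ x → lowerOr x j , j) (p (F.suc j))

  arcsOf : PredMap (suc m) → List (Arc m)
  arcsOf p = mapMaybe (arcInto p) (allFin m)

  arcInto⁻ : ∀ p {j a} → arcInto p j ≡ just a →
    ∃ λ x → p (F.suc j) ≡ just x × a ≡ (lowerOr x j , j)
  arcInto⁻ p {j} e with p (F.suc j)
  arcInto⁻ p refl | just x = x , refl , refl

  ∈-arcsOf⁻ : ∀ p {a} → a ∈ arcsOf p →
    ∃₂ λ j x → p (F.suc j) ≡ just x × a ≡ (lowerOr x j , j)
  ∈-arcsOf⁻ p a∈ with ∈-mapMaybe⁻ {f = arcInto p} {xs = allFin m} a∈
  ... | j , _ , e = j , arcInto⁻ p e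

  ∈-arcsOf⁺ : ∀ p {j x} → p (F.suc j) ≡ just x → (lowerOr x j , j) ∈ arcsOf p
  ∈-arcsOf⁺ p e = ∈-mapMaybe⁺ {f = arcInto p} (MemP.∈-allFin _) (cong (May.map _) e)

  arcsOf-unique : ∀ p → Unique (arcsOf p)
  arcsOf-unique p = mapMaybe-unique {f = arcInto p} sameHead (UniqueP.allFin⁺ m)
    where
    sameHead : ∀ {j j′ a} → arcInto p j ≡ just a → arcInto p j′ ≡ just a → j ≡ j′
    sameHead e e′ with arcInto⁻ p e | arcInto⁻ p e′
    ... | _ , _ , a≡ | _ , _ , a≡′ = cong proj₂ (trans (sym a≡) a≡′)

  arcsOf-cong : ∀ {p q} → p ≗ q → arcsOf p ≡ arcsOf q
  arcsOf-cong p≗q = LP.mapMaybe-cong (λ j → cong (May.map _) (p≗q (F.suc j))) (allFin m)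

  length-roots+arcsOf : ∀ p → p F.zero ≡ nothing → length (roots p) + length (arcsOf p) ≡ suc m
  length-roots+arcsOf p p0 = begin
    length (roots p) + length (arcsOf p)
      ≡⟨ cong (λ rs → length rs + length (arcsOf p)) (LP.filter-accept (isRoot? p) p0) ⟩
    suc (length (filter (isRoot? p) (tabulate F.suc)) + length (arcsOf p))
      ≡⟨ cong (λ js → suc (length (filter (isRoot? p) js) + length (arcsOf p)))
              (LP.map-tabulate (λ j → j) F.suc) ⟨
    suc (length (filter (isRoot? p) (map F.suc (allFin m))) + length (arcsOf p))
      ≡⟨ cong suc (count (allFin m)) ⟩
    suc (length (allFin m))
      ≡⟨ cong suc (LP.length-tabulate (λ j → j)) ⟩
    suc m ∎
    where
    open ≡-Reasoning
    count : ∀ js →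
      length (filter (isRoot? p) (map F.suc js)) + length (mapMaybe (arcInto p) js) ≡ length js
    count [] = refl
    count (j ∷ js) with p (F.suc j)
    ... | nothing = cong suc (count js)
    ... | just _ = trans (NP.+-suc _ _) (cong suc (count js))

  sourceInto : List (Arc m) → Fin m → Maybe (Fin m)
  sourceInto [] j = nothing
  sourceInto ((i , j′) ∷ G) j with j′ F.≟ j
  ... | yes _ = just i
  ... | no _ = sourceInto G j

  sourceInto-sound : ∀ G {i j} → sourceInto G j ≡ just i → (i , j) ∈ G
  sourceInto-sound ((i′ , j′) ∷ G) {j = j} e with j′ F.≟ j
  sourceInto-sound ((i′ , j′) ∷ G) refl | yes refl = here refl
  ... | no _ = there (sourceInto-sound G e)

  HeadsDistinct : List (Arc m) → Set
  HeadsDistinct = AllPairs (_≢_ on proj₂)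

  sourceInto-complete : ∀ {G i j} → HeadsDistinct G → (i , j) ∈ G → sourceInto G j ≡ just i
  sourceInto-complete {(i′ , j′) ∷ G} {j = j} (≢heads ∷ distinct) i,j∈ with j′ F.≟ j | i,j∈
  ... | yes _ | here refl = refl
  ... | yes refl | there i,j∈G = ⊥-elim (All.lookup ≢heads i,j∈G refl)
  ... | no j′≢j | here refl = ⊥-elim (j′≢j refl)
  ... | no _ | there i,j∈G = sourceInto-complete distinct i,j∈G

  sourceInto-↭ : ∀ {G G′} → HeadsDistinct G → HeadsDistinct G′ → G ↭ G′ →
    sourceInto G ≗ sourceInto G′
  sourceInto-↭ {G} {G′} distinct distinct′ σ j with sourceInto G j in e | sourceInto G′ j in e′
  ... | just _ | _ =
    sym (trans (sym e′) (sourceInto-complete distinct′ (PermP.∈-resp-↭ σ (sourceInto-sound G e))))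
  ... | nothing | nothing = refl
  ... | nothing | just _
    with trans (sym e) (sourceInto-complete distinct (PermP.∈-resp-↭ (↭-sym σ) (sourceInto-sound G′ e′)))
  ...   | ()

  predMapOf : List (Arc m) → PredMap (suc m)
  predMapOf G F.zero = nothing
  predMapOf G (F.suc j) = May.map inject₁ (sourceInto G j)

  predMapOf-just⁻ : ∀ G {j x} → predMapOf G (F.suc j) ≡ just x →
    ∃ λ i → sourceInto G j ≡ just i × x ≡ inject₁ i
  predMapOf-just⁻ G {j} e with sourceInto G j
  predMapOf-just⁻ G refl | just i = i , refl , refl

  predMapOf-just⁺ : ∀ G {j i} → sourceInto G j ≡ just i → predMapOf G (F.suc j) ≡ just (inject₁ i)
  predMapOf-just⁺ G e = cong (May.map inject₁) e

  independent⇒headsDistinct : ∀ {G} → AllPairs Independent G → HeadsDistinct G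
  independent⇒headsDistinct = AP.map (λ (_ , _ , _ , j≢j′) → j≢j′)

  independent⇒unique : ∀ {G} → AllPairs Independent G → Unique G
  independent⇒unique = AP.map distinct
    where
    distinct : ∀ {a a′ : Arc m} → Independent a a′ → a ≢ a′
    distinct (i≢i′ , _) refl = i≢i′ refl

  predMapOf-↭ : ∀ {G G′} → AllPairs Independent G → AllPairs Independent G′ → G ↭ G′ →
    predMapOf G ≗ predMapOf G′
  predMapOf-↭ ind ind′ σ F.zero = refl
  predMapOf-↭ ind ind′ σ (F.suc j) = cong (May.map inject₁)
    (sourceInto-↭ (independent⇒headsDistinct ind) (independent⇒headsDistinct ind′) σ j)

module ArcsOfNCPredMap {m : ℕ} {p : PredMap (suc m)} (isNC : IsNCPredMap p) where
  open IsNCPredMap isNC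

  source≤head : ∀ {j x} → p (F.suc j) ≡ just x → toℕ x N.≤ toℕ j
  source≤head e = NP.≤-pred (decreasing e)

  toℕ-source : ∀ {j x} → p (F.suc j) ≡ just x → toℕ (lowerOr x j) ≡ toℕ x
  toℕ-source e = toℕ-lowerOr (source≤head e)

  inject₁-source : ∀ {j x} → p (F.suc j) ≡ just x → inject₁ (lowerOr x j) ≡ x
  inject₁-source e = inject₁-lowerOr (source≤head e)

  -- Were j′ the source of the arc into j, the links x′ → j′ + 1 and j′ → j + 1 would cross.
  source≢head : ∀ {j j′ x x′} → j ≢ j′ → p (F.suc j) ≡ just x → p (F.suc j′) ≡ just x′ →
    lowerOr x j ≢ j′
  source≢head {j} {j′} {x} {x′} j≢j′ e e′ x≡j′ with x′ F.≟ x
  ... | yes refl = j≢j′ (FP.suc-injective (injective e e′))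
  ... | no x′≢x = noncrossing e′ e (x′<x , NP.≤-reflexive (cong suc x≡ℕj′) , j′<j)
    where
    x≡ℕj′ : toℕ x ≡ toℕ j′
    x≡ℕj′ = trans (sym (toℕ-source e)) (cong toℕ x≡j′)
    x′<x : toℕ x′ N.< toℕ x
    x′<x = FP.≤∧≢⇒< (subst (toℕ x′ N.≤_) (sym x≡ℕj′) (source≤head e′)) x′≢x
    j′<j : suc (toℕ j′) N.< suc (toℕ j)
    j′<j = N.s≤s (FP.≤∧≢⇒< (subst (N._≤ toℕ j) x≡ℕj′ (source≤head e)) (λ j′≡j → j≢j′ (sym j′≡j)))

  arcs-independent : ∀ {j j′ x x′} → j ≢ j′ → p (F.suc j) ≡ just x → p (F.suc j′) ≡ just x′ →
    Independent (lowerOr x j , j) (lowerOr x′ j′ , j′)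
  arcs-independent {x = x} {x′} j≢j′ e e′ =
      (λ lx≡lx′ → x≢x′ (trans (sym (inject₁-source e)) (trans (cong inject₁ lx≡lx′) (inject₁-source e′))))
    , source≢head j≢j′ e e′
    , (λ j≡lx′ → source≢head (λ j′≡j → j≢j′ (sym j′≡j)) e′ e (sym j≡lx′))
    , j≢j′
    where
    x≢x′ : x ≢ x′
    x≢x′ refl = j≢j′ (FP.suc-injective (injective e e′))

  arcsOf-independent : AllPairs Independent (arcsOf p)
  arcsOf-independent = unique⇒AllPairs (arcsOf-unique p) independent
    where
    independent : ∀ {a b} → a ∈ arcsOf p → b ∈ arcsOf p → a ≢ b → Independent a b
    independent a∈ b∈ a≢b with ∈-arcsOf⁻ p a∈ | ∈-arcsOf⁻ p b∈
    ... | j , x , e , refl | j′ , x′ , e′ , refl = arcs-independent j≢j′ e e′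
      where
      j≢j′ : j ≢ j′
      j≢j′ refl with trans (sym e) e′
      ... | refl = a≢b refl

  arcsOf-loopOrUp : All LoopOrUp (arcsOf p)
  arcsOf-loopOrUp = All.tabulate loopOrUp
    where
    loopOrUp : ∀ {a} → a ∈ arcsOf p → LoopOrUp a
    loopOrUp a∈ with ∈-arcsOf⁻ p a∈
    ... | j , x , e , refl with NP.m≤n⇒m<n∨m≡n (subst (N._≤ toℕ j) (sym (toℕ-source e)) (source≤head e))
    ...   | inj₁ i<j = inj₂ i<j
    ...   | inj₂ i≡j = inj₁ (FP.toℕ-injective i≡j)

  arcsOf-noncrossing : ArcsNonCrossing (arcsOf p)
  arcsOf-noncrossing a b c d ab∈ cd∈ (a<c , c<b , b<d) with ∈-arcsOf⁻ p ab∈ | ∈-arcsOf⁻ p cd∈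
  ... | _ , _ , e , refl | _ , _ , e′ , refl =
    noncrossing e e′ (subst₂ N._<_ (toℕ-source e) (toℕ-source e′) a<c ,
                      NP.m<n⇒m<1+n (subst (N._< _) (toℕ-source e′) c<b) , N.s≤s b<d)

  predMapOf-arcsOf : p ≗ predMapOf (arcsOf p)
  predMapOf-arcsOf F.zero = isRoot-zero isNC
  predMapOf-arcsOf (F.suc j) with p (F.suc j) in e
  ... | just x = sym (begin
    predMapOf (arcsOf p) (F.suc j)
      ≡⟨ predMapOf-just⁺ (arcsOf p)
           (sourceInto-complete (independent⇒headsDistinct arcsOf-independent) (∈-arcsOf⁺ p e)) ⟩
    just (inject₁ (lowerOr x j))
      ≡⟨ cong just (inject₁-source e) ⟩
    just x ∎)
    where open ≡-Reasoning
  ... | nothing with sourceInto (arcsOf p) j in e′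
  ...   | nothing = refl
  ...   | just _ with ∈-arcsOf⁻ p (sourceInto-sound (arcsOf p) e′)
  ...     | _ , _ , e″ , refl with trans (sym e) e″
  ...       | ()

module PredMapOfArcs {m : ℕ} {G : List (Arc m)}
  (loopOrUp : All LoopOrUp G) (ind : AllPairs Independent G) (nc : ArcsNonCrossing G) where

  source≤head : ∀ {i j} → (i , j) ∈ G → i F.≤ j
  source≤head i,j∈ with All.lookup loopOrUp i,j∈
  ... | inj₁ refl = NP.≤-refl
  ... | inj₂ i<j = NP.<⇒≤ i<j

  arc∈ : ∀ {j x} → predMapOf G (F.suc j) ≡ just x → ∃ λ i → (i , j) ∈ G × x ≡ inject₁ i
  arc∈ e with predMapOf-just⁻ G e
  ... | i , s , x≡ = i , sourceInto-sound G s , x≡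

  decreasing : ∀ {y x} → predMapOf G y ≡ just x → x F.< y
  decreasing {F.suc j} e with arc∈ e
  ... | i , i,j∈ , refl = N.s≤s (subst (N._≤ toℕ j) (sym (FP.toℕ-inject₁ i)) (source≤head i,j∈))

  injective : ∀ {y y′ x} → predMapOf G y ≡ just x → predMapOf G y′ ≡ just x → y ≡ y′
  injective {F.suc j} {F.suc j′} e e′ with arc∈ e | arc∈ e′
  ... | i , i,j∈ , refl | i′ , i′,j′∈ , i≡i′ with FP.inject₁-injective i≡i′
  ...   | refl with AllPairs-lookup₂ ind i,j∈ i′,j′∈
  ...     | inj₁ refl = refl
  ...     | inj₂ (inj₁ (i≢i , _)) = ⊥-elim (i≢i refl)
  ...     | inj₂ (inj₂ (i≢i , _)) = ⊥-elim (i≢i refl)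

  -- A crossing of links a → b + 1, c → d + 1 is a crossing of the arcs (a , b), (c , d),
  -- unless c = b, which independence excludes.
  noncrossing : ∀ {a b c d} → predMapOf G b ≡ just a → predMapOf G d ≡ just c →
    ¬ (a F.< c × c F.< b × b F.< d)
  noncrossing {b = F.suc b} {d = F.suc d} e e′ (a<c , c<b , b<d) with arc∈ e | arc∈ e′
  ... | a , a,b∈ , refl | c , c,d∈ , refl
    with subst₂ N._<_ (FP.toℕ-inject₁ a) (FP.toℕ-inject₁ c) a<c
       | NP.m≤n⇒m<n∨m≡n (NP.≤-pred (subst (N._< suc (toℕ b)) (FP.toℕ-inject₁ c) c<b))
  ... | a<ℕc | inj₁ c<ℕb = nc a b c d a,b∈ c,d∈ (a<ℕc , c<ℕb , NP.≤-pred b<d)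
  ... | a<ℕc | inj₂ c≡ℕb with AllPairs-lookup₂ ind a,b∈ c,d∈
  ...   | inj₁ refl = NP.<-irrefl refl a<ℕc
  ...   | inj₂ (inj₁ (_ , _ , b≢c , _)) = b≢c (sym (FP.toℕ-injective c≡ℕb))
  ...   | inj₂ (inj₂ (_ , c≢b , _)) = c≢b (FP.toℕ-injective c≡ℕb)

  predMapOf-isNC : IsNCPredMap (predMapOf G)
  predMapOf-isNC = record { decreasing = decreasing ; injective = injective ; noncrossing = noncrossing }

  arcsOf-predMapOf : arcsOf (predMapOf G) ↭ G
  arcsOf-predMapOf = unique-sameMembers⇒↭ (arcsOf-unique (predMapOf G)) (independent⇒unique ind) to from
    where
    arc≡ : ∀ {i j} → (i , j) ∈ G → (lowerOr (inject₁ i) j , j) ≡ (i , j)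
    arc≡ {j = j} i,j∈ = cong (_, j) (lowerOr-inject₁ (source≤head i,j∈))
    to : ∀ {a} → a ∈ arcsOf (predMapOf G) → a ∈ G
    to a∈ with ∈-arcsOf⁻ (predMapOf G) a∈
    ... | _ , _ , e , refl with arc∈ e
    ...   | _ , i,j∈ , refl = subst (_∈ G) (sym (arc≡ i,j∈)) i,j∈
    from : ∀ {a} → a ∈ G → a ∈ arcsOf (predMapOf G)
    from i,j∈ = subst (_∈ arcsOf (predMapOf G)) (arc≡ i,j∈) (∈-arcsOf⁺ (predMapOf G)
      (predMapOf-just⁺ G (sourceInto-complete (independent⇒headsDistinct ind) i,j∈)))

module _ {m k : ℕ} where

  toArcSystem : NCPredMap (suc m) k → ArcSystem (suc m) k
  toArcSystem (p , isNC , len) =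
    arcsOf p , arcsOf-loopOrUp , arcsOf-independent , arcsOf-noncrossing , length-arcsOf
    where
    open ArcsOfNCPredMap isNC
    length-arcsOf : length (arcsOf p) ≡ suc m ∸ k
    length-arcsOf = begin
      length (arcsOf p)
        ≡⟨ NP.m+n∸m≡n (length (roots p)) _ ⟨
      length (roots p) + length (arcsOf p) ∸ length (roots p)
        ≡⟨ cong₂ _∸_ (length-roots+arcsOf p (isRoot-zero isNC)) len ⟩
      suc m ∸ k ∎
      where open ≡-Reasoning

  toArcSystem-injective : ∀ {p q : NCPredMap (suc m) k} → arcsOf (proj₁ p) ↭ arcsOf (proj₁ q) →
    proj₁ p ≗ proj₁ q
  toArcSystem-injective {p , isNCp , _} {q , isNCq , _} σ y = begin
    p y                        ≡⟨ P.predMapOf-arcsOf y ⟩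
    predMapOf (arcsOf p) y     ≡⟨ predMapOf-↭ P.arcsOf-independent Q.arcsOf-independent σ y ⟩
    predMapOf (arcsOf q) y     ≡⟨ Q.predMapOf-arcsOf y ⟨
    q y                        ∎
    where
    open ≡-Reasoning
    module P = ArcsOfNCPredMap isNCp
    module Q = ArcsOfNCPredMap isNCq

  toArcSystem-surjective : k ≤ suc m → ∀ (G : ArcSystem (suc m) k) → Σ (NCPredMap (suc m) k) λ p →
    ∀ {q : NCPredMap (suc m) k} → proj₁ q ≗ proj₁ p → arcsOf (proj₁ q) ↭ proj₁ G
  toArcSystem-surjective k≤n (G , loopOrUp , ind , nc , len) =
    (predMapOf G , predMapOf-isNC , length-roots) ,
    λ q≗p → ↭-trans (↭-reflexive (arcsOf-cong q≗p)) arcsOf-predMapOf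
    where
    open PredMapOfArcs loopOrUp ind nc
    length-roots : length (roots (predMapOf G)) ≡ k
    length-roots = NP.+-cancelʳ-≡ (suc m ∸ k) _ _ (begin
      length (roots (predMapOf G)) + (suc m ∸ k)
        ≡⟨ cong (length (roots (predMapOf G)) +_) (trans (PermP.↭-length arcsOf-predMapOf) len) ⟨
      length (roots (predMapOf G)) + length (arcsOf (predMapOf G))
        ≡⟨ length-roots+arcsOf (predMapOf G) refl ⟩
      suc m
        ≡⟨ NP.m+[n∸m]≡n k≤n ⟨
      k + (suc m ∸ k) ∎)
      where open ≡-Reasoning

predMap⤖arcSystem : ∀ m k → k ≤ suc m →
  Bijection (NCPredMapSetoid (suc m) k) (ArcSystemSetoid (suc m) k)
predMap⤖arcSystem m k k≤n = record
  { to        = toArcSystem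
  ; cong      = λ p≗q → ↭-reflexive (arcsOf-cong p≗q)
  ; bijective = (λ {p} {q} → toArcSystem-injective {p = p} {q}) , toArcSystem-surjective k≤n
  }

theorem3p2 : (n k : ℕ) → 1 ≤ k → k ≤ n →
    Bijection (NCPartitionSetoid n k) (ArcSystemSetoid n k)
theorem3p2 zero (suc k) _ ()
theorem3p2 (suc m) k _ k≤n =
  Compose.bijection (partition⤖predMap (suc m) k) (predMap⤖arcSystem m k k≤n)
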